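{- Let $p$ be a prime, let $n$ be a positive integer divisible by $p^3$, and let $R$ be a type-$p$ most-perfect square of order $n$. Then $\theta(R)$ is semi-magic (every row and every column sums to $\frac{n(n^2-1)}{2}$), possesses the $p\times p$ property, possesses the $1/p$ row and column properties, and is pandiagonal (every broken diagonal in either direction sums to $\frac{n(n^2-1)}{2}$).
   Context: A natural square of order $n$ is an $n\times n$ array containing each of $0,1,\dots,n^2-1$ exactly once; its magic sum is $\frac{n(n^2-1)}{2}$. Rows and columns are indexed $0,\dots,n-1$ with indices read modulo $n$. A natural square is pandiagonal magic if every row, every column, and every broken diagonal in either direction sums to $\frac{n(n^2-1)}{2}$. An $n\times n$ array has the $p\times p$ property if the entries of every $p\times p$ subsquare formed from consecutive rows and columns (allowing toric wraparound) sum to $\frac{p^2(n^2-1)}{2}$. For $p\mid n$, a type-$p$ most-perfect square of order $n$ is a natural pandiagonal magic square $R$ of order $n$ with the $p\times p$ property and the complementary property: for every position $(r,c)$, the entries at positions $(r+t\frac np,\,c+t\frac np)$ (indices mod $n$), $t=0,\dots,p-1$, sum to $\frac{p(n^2-1)}{2}$. A square $S$ of order $n$ has the $1/p$ column property if, when each column is split into the $p$ parts consisting of rows $s\frac np,\dots,(s+1)\frac np-1$ ($s=0,\dots,p-1$), the entries in each part sum to $\frac{n(n^2-1)}{2p}$; the $1/p$ row property is defined analogously. The map $\theta$ (depending on $p$) is defined on $n\times n$ arrays with $p^2\mid n$: view $R$ as a $p^2\times p^2$ block array $(R_{i,j})_{0\le i,j\le p^2-1}$ of $\frac{n}{p^2}\times\frac{n}{p^2}$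 blocks; for $i=\ell p+m$ with $\ell,m\in\{0,\dots,p-1\}$ put $\bar i=mp+\ell$; then $[\theta(R)]_{i,j}=R_{\bar i,\bar j}$. -}

module Defs where

open import Data.Nat using (ℕ; zero; suc; _+_; _*_; _∸_; _<_; _/_; _%_)
open import Data.Nat.DivMod using (m%n<n)
open import Data.Fin using (Fin; toℕ; fromℕ<)
open import Data.Product using (Σ; _×_; _,_; ∃)
open import Relation.Binary.PropositionalEquality using (_≡_)

Square : ℕ → Set
Square n = Fin n → Fin n → ℕ

-- Division by a positive divisor (only ever used with positive divisors
-- that divide exactly: n / p, n / p², ...).  Defined total by 0 for p = 0.
_÷_ : ℕ → ℕ → ℕ
m ÷ zero  = 0
m ÷ suc k = m / suc k

idx : (k : ℕ) → ℕ → Fin (suc k)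
idx k i = fromℕ< (m%n<n i (suc k))

-- Entry at position (r mod n, c mod n) (toric wraparound).
ent : {n : ℕ} → Square n → ℕ → ℕ → ℕ
ent {zero}  R r c = 0
ent {suc k} R r c = R (idx k r) (idx k c)

sumTo : ℕ → (ℕ → ℕ) → ℕ
sumTo zero    f = 0
sumTo (suc k) f = sumTo k f + f k

Natural : {n : ℕ} → Square n → Set
Natural {n} R =
  (∀ r c → R r c < n * n) ×
  (∀ v → v < n * n →
     Σ (Fin n) λ r → Σ (Fin n) λ c → (R r c ≡ v) ×
       (∀ r' c' → R r' c' ≡ v → (r' ≡ r) × (c' ≡ c)))

-- All sum conditions are stated doubled (2·S = n(n²-1) etc.) to avoid
-- non-integer right-hand sides.
RowsMagic : {n : ℕ} → Square n → Set
RowsMagic {n} R = ∀ (r : Fin n) →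
  2 * sumTo n (λ c → ent R (toℕ r) c) ≡ n * (n * n ∸ 1)

ColsMagic : {n : ℕ} → Square n → Set
ColsMagic {n} R = ∀ (c : Fin n) →
  2 * sumTo n (λ r → ent R r (toℕ c)) ≡ n * (n * n ∸ 1)

SemiMagic : {n : ℕ} → Square n → Set
SemiMagic R = RowsMagic R × ColsMagic R

Pandiagonal : {n : ℕ} → Square n → Set
Pandiagonal {n} R =
  (∀ (k : Fin n) → 2 * sumTo n (λ i → ent R i (toℕ k + i)) ≡ n * (n * n ∸ 1)) ×
  (∀ (k : Fin n) → 2 * sumTo n (λ i → ent R i (toℕ k + (n ∸ i))) ≡ n * (n * n ∸ 1))

PandiagonalMagic : {n : ℕ} → Square n → Set
PandiagonalMagic R = Natural R × SemiMagic R × Pandiagonal R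

PxPProperty : (p : ℕ) → {n : ℕ} → Square n → Set
PxPProperty p {n} R = ∀ (r c : Fin n) →
  2 * sumTo p (λ a → sumTo p (λ b → ent R (toℕ r + a) (toℕ c + b)))
    ≡ p * p * (n * n ∸ 1)

Complementary : (p : ℕ) → {n : ℕ} → Square n → Set
Complementary p {n} R = ∀ (r c : Fin n) →
  2 * sumTo p (λ t → ent R (toℕ r + t * (n ÷ p)) (toℕ c + t * (n ÷ p)))
    ≡ p * (n * n ∸ 1)

-- Type-p most-perfect square of order n (p ∣ n assumed separately).
MostPerfect : (p : ℕ) → {n : ℕ} → Square n → Set
MostPerfect p R = PandiagonalMagic R × PxPProperty p R × Complementary p R

ColPart : (p : ℕ) → {n : ℕ} → Square n → Set
ColPart p {n} R = ∀ (c : Fin n) (s : ℕ) → s < p →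
  2 * p * sumTo (n ÷ p) (λ i → ent R (s * (n ÷ p) + i) (toℕ c))
    ≡ n * (n * n ∸ 1)

RowPart : (p : ℕ) → {n : ℕ} → Square n → Set
RowPart p {n} R = ∀ (r : Fin n) (s : ℕ) → s < p →
  2 * p * sumTo (n ÷ p) (λ i → ent R (toℕ r) (s * (n ÷ p) + i))
    ≡ n * (n * n ∸ 1)

bar : ℕ → ℕ → ℕ
bar zero    i = i
bar (suc k) i = (i % suc k) * suc k + i / suc k

θidx : (p n : ℕ) → ℕ → ℕ
θidx p n r with n ÷ (p * p)
... | zero    = r
... | suc b   = bar p (r / suc b) * suc b + r % suc b

θ : (p : ℕ) → {n : ℕ} → Square n → Square n
θ p {n} R r c = ent R (θidx p n (toℕ r)) (θidx p n (toℕ c))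

module Submission where

-- Constancy of the p×p window sums makes every rectangle with sides in pℕ balanced, so each
-- entry splits as f r c = f r (c mod p) + f (r mod p) c − f (r mod p) (c mod p).  θ applies
-- one permutation Θ of ℤ/n to both rows and columns; it moves whole blocks of n/p² indices, a
-- multiple of p, so it preserves residues mod p.  Over a p×p window or a broken diagonal the
-- three correction terms see Θ only through residues mod p or through a reordering of all
-- indices, hence such sums agree for θ(R) and R; rows and columns of θ(R) are permuted rows
-- and columns of R.  The s-th band of n/p columns of θ(R) is the union of the column blocks s,
-- s + p, …, s + (p − 1)p of R; grouping it into row windows of width p and shifting the μ-th
-- block by μ·n/p rows (row windows are p-periodic in the row) turns the band sum into a sum of
-- complementary p-tuples.

open import Defs
open import Data.Nat
open import Data.Nat.Properties
open import Data.Nat.DivMod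
open import Data.Nat.Divisibility using (_∣_; divides; ∣n⇒∣m*n; n∣m*n; m∣m*n)
open import Data.Nat.Primality using (Prime; prime⇒nonZero)
open import Data.Fin using (Fin; toℕ; fromℕ<)
open import Data.Fin.Properties using (toℕ-fromℕ<; toℕ-injective; toℕ<n)
open import Data.Product using (_×_; _,_)
open import Data.Nat.Tactic.RingSolver using (solve-∀)
open import Algebra.Properties.CommutativeSemigroup +-commutativeSemigroup
  using (interchange; xy∙z≈xz∙y; x∙yz≈xz∙y)
open import Relation.Binary.PropositionalEquality
open ≡-Reasoning

sumTo-cong : ∀ n {f g : ℕ → ℕ} → (∀ i → f i ≡ g i) → sumTo n f ≡ sumTo n g
sumTo-cong zero    f≗g = refl
sumTo-cong (suc n) f≗g = cong₂ _+_ (sumTo-cong n f≗g) (f≗g n)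

sumTo-cong< : ∀ n {f g : ℕ → ℕ} → (∀ i → i < n → f i ≡ g i) → sumTo n f ≡ sumTo n g
sumTo-cong< zero    f≗g = refl
sumTo-cong< (suc n) f≗g =
  cong₂ _+_ (sumTo-cong< n (λ i i<n → f≗g i (m<n⇒m<1+n i<n))) (f≗g n ≤-refl)

sumTo-distrib-+ : ∀ n (f g : ℕ → ℕ) →
                  sumTo n (λ i → f i + g i) ≡ sumTo n f + sumTo n g
sumTo-distrib-+ zero    f g = refl
sumTo-distrib-+ (suc n) f g = begin
  sumTo n (λ i → f i + g i) + (f n + g n) ≡⟨ cong (_+ (f n + g n)) (sumTo-distrib-+ n f g) ⟩
  sumTo n f + sumTo n g + (f n + g n)     ≡⟨ interchange (sumTo n f) (sumTo n g) (f n) (g n) ⟩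
  sumTo n f + f n + (sumTo n g + g n)     ∎

sumTo-cong-+ : ∀ n {f g h k : ℕ → ℕ} → (∀ i → f i + g i ≡ h i + k i) →
               sumTo n f + sumTo n g ≡ sumTo n h + sumTo n k
sumTo-cong-+ n {f} {g} {h} {k} eq = begin
  sumTo n f + sumTo n g         ≡⟨ sym (sumTo-distrib-+ n f g) ⟩
  sumTo n (λ i → f i + g i)     ≡⟨ sumTo-cong n eq ⟩
  sumTo n (λ i → h i + k i)     ≡⟨ sumTo-distrib-+ n h k ⟩
  sumTo n h + sumTo n k         ∎

sumTo-*ˡ : ∀ n k (f : ℕ → ℕ) → sumTo n (λ i → k * f i) ≡ k * sumTo n f
sumTo-*ˡ zero    k f = sym (*-zeroʳ k)
sumTo-*ˡ (suc n) k f =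
  trans (cong (_+ k * f n) (sumTo-*ˡ n k f)) (sym (*-distribˡ-+ k (sumTo n f) (f n)))

sumTo-const : ∀ n c → sumTo n (λ _ → c) ≡ n * c
sumTo-const zero    c = refl
sumTo-const (suc n) c = trans (cong (_+ c) (sumTo-const n c)) (+-comm (n * c) c)

sumTo-head : ∀ n (f : ℕ → ℕ) → sumTo (suc n) f ≡ f 0 + sumTo n (λ i → f (suc i))
sumTo-head zero    f = +-comm 0 (f 0)
sumTo-head (suc n) f = begin
  sumTo (suc n) f + f (suc n)                 ≡⟨ cong (_+ f (suc n)) (sumTo-head n f) ⟩
  f 0 + sumTo n (λ i → f (suc i)) + f (suc n) ≡⟨ +-assoc (f 0) _ _ ⟩
  f 0 + (sumTo n (λ i → f (suc i)) + f (suc n)) ∎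

sumTo-splitAt : ∀ a b (f : ℕ → ℕ) → sumTo (a + b) f ≡ sumTo a f + sumTo b (λ j → f (a + j))
sumTo-splitAt a zero    f = trans (cong (λ m → sumTo m f) (+-identityʳ a)) (sym (+-identityʳ _))
sumTo-splitAt a (suc b) f = begin
  sumTo (a + suc b) f                                ≡⟨ cong (λ m → sumTo m f) (+-suc a b) ⟩
  sumTo (a + b) f + f (a + b)                        ≡⟨ cong (_+ f (a + b)) (sumTo-splitAt a b f) ⟩
  sumTo a f + sumTo b (λ j → f (a + j)) + f (a + b)  ≡⟨ +-assoc (sumTo a f) _ _ ⟩
  sumTo a f + (sumTo b (λ j → f (a + j)) + f (a + b)) ∎

sumTo-blocks : ∀ a b (f : ℕ → ℕ) →
               sumTo (a * b) f ≡ sumTo a (λ i → sumTo b (λ j → f (i * b + j)))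
sumTo-blocks zero    b f = refl
sumTo-blocks (suc a) b f = begin
  sumTo (b + a * b) f                             ≡⟨ cong (λ m → sumTo m f) (+-comm b (a * b)) ⟩
  sumTo (a * b + b) f                             ≡⟨ sumTo-splitAt (a * b) b f ⟩
  sumTo (a * b) f + sumTo b (λ j → f (a * b + j))
    ≡⟨ cong (_+ sumTo b (λ j → f (a * b + j))) (sumTo-blocks a b f) ⟩
  sumTo a (λ i → sumTo b (λ j → f (i * b + j))) + sumTo b (λ j → f (a * b + j)) ∎

sumTo-comm : ∀ a b (f : ℕ → ℕ → ℕ) →
             sumTo a (λ i → sumTo b (f i)) ≡ sumTo b (λ j → sumTo a (λ i → f i j))
sumTo-comm zero    b f = sym (trans (sumTo-const b 0) (*-zeroʳ b))
sumTo-comm (suc a) b f = begin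
  sumTo a (λ i → sumTo b (f i)) + sumTo b (f a)         ≡⟨ cong (_+ sumTo b (f a)) (sumTo-comm a b f) ⟩
  sumTo b (λ j → sumTo a (λ i → f i j)) + sumTo b (f a) ≡⟨ sym (sumTo-distrib-+ b _ _) ⟩
  sumTo b (λ j → sumTo a (λ i → f i j) + f a j)         ∎

sumTo-slide : ∀ n (f : ℕ → ℕ) k →
              f k + sumTo n (λ i → f (suc k + i)) ≡ sumTo n (λ i → f (k + i)) + f (k + n)
sumTo-slide n f k = begin
  f k + sumTo n (λ i → f (suc k + i))       ≡⟨ cong₂ _+_ (cong f (sym (+-identityʳ k)))
                                                        (sumTo-cong n (λ i → cong f (sym (+-suc k i)))) ⟩
  f (k + 0) + sumTo n (λ i → f (k + suc i)) ≡⟨ sym (sumTo-head n (λ i → f (k + i))) ⟩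
  sumTo n (λ i → f (k + i)) + f (k + n)     ∎

sumTo-shift-periodic : ∀ n (f : ℕ → ℕ) → (∀ x → f (x + n) ≡ f x) →
                       ∀ k → sumTo n (λ i → f (k + i)) ≡ sumTo n f
sumTo-shift-periodic n f per zero    = refl
sumTo-shift-periodic n f per (suc k) = +-cancelˡ-≡ (f k) _ _ (begin
  f k + sumTo n (λ i → f (suc k + i))   ≡⟨ sumTo-slide n f k ⟩
  sumTo n (λ i → f (k + i)) + f (k + n) ≡⟨ cong₂ _+_ (sumTo-shift-periodic n f per k) (per k) ⟩
  sumTo n f + f k                       ≡⟨ +-comm (sumTo n f) (f k) ⟩
  f k + sumTo n f                       ∎)

sumTo-reverse : ∀ n (f : ℕ → ℕ) → sumTo n (λ i → f (n ∸ i)) ≡ sumTo n (λ i → f (suc i))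
sumTo-reverse zero    f = refl
sumTo-reverse (suc n) f = begin
  sumTo n (λ i → f (suc n ∸ i)) + f (suc n ∸ n)
    ≡⟨ cong₂ _+_ (sumTo-cong< n (λ i i<n → cong f (+-∸-assoc 1 (<⇒≤ i<n))))
                 (cong f (+-∸-assoc 1 {n} ≤-refl)) ⟩
  sumTo n (λ i → f (suc (n ∸ i))) + f (suc (n ∸ n))
    ≡⟨ cong₂ _+_ (sumTo-reverse n (λ x → f (suc x))) (cong (λ x → f (suc x)) (n∸n≡0 n)) ⟩
  sumTo n (λ i → f (suc (suc i))) + f 1
    ≡⟨ +-comm _ (f 1) ⟩
  f 1 + sumTo n (λ i → f (suc (suc i)))
    ≡⟨ sym (sumTo-head n (λ i → f (suc i))) ⟩
  sumTo (suc n) (λ i → f (suc i)) ∎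

sumTo-mod-shift : ∀ n .{{_ : NonZero n}} (f : ℕ → ℕ) k →
                  sumTo n (λ i → f ((k + i) % n)) ≡ sumTo n f
sumTo-mod-shift n f k =
  trans (sumTo-shift-periodic n (λ x → f (x % n)) (λ x → cong f ([m+n]%n≡m%n x n)) k)
        (sumTo-cong< n (λ i i<n → cong f (m<n⇒m%n≡m i<n)))

[m%d+n]%d≡[m+n]%d : ∀ m n d .{{_ : NonZero d}} → (m % d + n) % d ≡ (m + n) % d
[m%d+n]%d≡[m+n]%d m n d = begin
  (m % d + n) % d           ≡⟨ %-distribˡ-+ (m % d) n d ⟩
  (m % d % d + n % d) % d   ≡⟨ cong (λ x → (x + n % d) % d) (m%n%n≡m%n m d) ⟩
  (m % d + n % d) % d       ≡⟨ sym (%-distribˡ-+ m n d) ⟩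
  (m + n) % d               ∎

[m+n%d]%d≡[m+n]%d : ∀ m n d .{{_ : NonZero d}} → (m + n % d) % d ≡ (m + n) % d
[m+n%d]%d≡[m+n]%d m n d =
  trans (%-congˡ (+-comm m (n % d))) (trans ([m%d+n]%d≡[m+n]%d n m d) (%-congˡ (+-comm n m)))

[m∸n%d]%d≡[m∸n]%d : ∀ {m n} d .{{_ : NonZero d}} → n ≤ m → (m ∸ n % d) % d ≡ (m ∸ n) % d
[m∸n%d]%d≡[m∸n]%d {m} {n} d n≤m = begin
  (m ∸ n % d) % d                 ≡⟨ %-congˡ (cong (_∸ n % d) (sym (m∸n+n≡m n≤m))) ⟩
  (m ∸ n + n ∸ n % d) % d         ≡⟨ %-congˡ (cong (λ x → m ∸ n + x ∸ n % d) (m≡m%n+[m/n]*n n d)) ⟩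
  (m ∸ n + (n % d + q) ∸ n % d) % d ≡⟨ %-congˡ (cong (_∸ n % d) (x∙yz≈xz∙y (m ∸ n) (n % d) q)) ⟩
  (m ∸ n + q + n % d ∸ n % d) % d ≡⟨ %-congˡ (m+n∸n≡m (m ∸ n + q) (n % d)) ⟩
  (m ∸ n + q) % d                 ≡⟨ [m+kn]%n≡m%n (m ∸ n) (n / d) d ⟩
  (m ∸ n) % d                     ∎
  where
  q : ℕ
  q = n / d * d

[j*b+o]/b≡j : ∀ b .{{_ : NonZero b}} j {o} → o < b → (j * b + o) / b ≡ j
[j*b+o]/b≡j b j {o} o<b = begin
  (j * b + o) / b       ≡⟨ /-congˡ (+-comm (j * b) o) ⟩
  (o + j * b) / b       ≡⟨ +-distrib-/-∣ʳ o (divides j refl) ⟩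
  o / b + j * b / b     ≡⟨ cong₂ _+_ (m<n⇒m/n≡0 o<b) (m*n/n≡m j b) ⟩
  j                     ∎

[j*b+o]%b≡o : ∀ b .{{_ : NonZero b}} j {o} → o < b → (j * b + o) % b ≡ o
[j*b+o]%b≡o b j {o} o<b =
  trans (%-congˡ (+-comm (j * b) o)) (trans ([m+kn]%n≡m%n o j b) (m<n⇒m%n≡m o<b))

j*b+o<a*b : ∀ {j o a} b → j < a → o < b → j * b + o < a * b
j*b+o<a*b {j} {o} {a} b j<a o<b =
  <-≤-trans (+-monoʳ-< (j * b) o<b) (subst (_≤ a * b) (+-comm b (j * b)) (*-monoˡ-≤ b j<a))

bar-swap : ∀ p .{{_ : NonZero p}} l {m} → m < p → bar p (l * p + m) ≡ m * p + l
bar-swap p@(suc _) l m<p =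
  cong₂ (λ u v → u * p + v) ([j*b+o]%b≡o p l m<p) ([j*b+o]/b≡j p l m<p)

-- h x′ y′ − h x′ y = h x y′ − h x y, stated without subtraction.
Balanced : (ℕ → ℕ → ℕ) → ℕ → ℕ → ℕ → ℕ → Set
Balanced h x x′ y y′ = h x y + h x′ y′ ≡ h x y′ + h x′ y

balanced-pasteˣ : ∀ h {x x′ x″ y y′} → Balanced h x x′ y y′ → Balanced h x′ x″ y y′ →
                  Balanced h x x″ y y′
balanced-pasteˣ h {x} {x′} {x″} {y} {y′} left right = +-cancelʳ-≡ (h x′ y + h x′ y′) _ _ (begin
  h x y + h x″ y′ + (h x′ y + h x′ y′)     ≡⟨ regroup (h x y) (h x″ y′) (h x′ y) (h x′ y′) ⟩
  (h x y + h x′ y′) + (h x′ y + h x″ y′)   ≡⟨ cong₂ _+_ left right ⟩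
  (h x y′ + h x′ y) + (h x′ y′ + h x″ y)   ≡⟨ regroup′ (h x y′) (h x′ y) (h x′ y′) (h x″ y) ⟩
  h x y′ + h x″ y + (h x′ y + h x′ y′)     ∎)
  where
  regroup : ∀ a b c d → a + b + (c + d) ≡ (a + d) + (c + b)
  regroup = solve-∀
  regroup′ : ∀ a b c d → (a + b) + (c + d) ≡ a + d + (b + c)
  regroup′ = solve-∀

balanced-transpose : ∀ h {x x′ y y′} → Balanced h x x′ y y′ → Balanced (λ u v → h v u) y y′ x x′
balanced-transpose h {x} {x′} {y} {y′} eq = trans eq (+-comm (h x y′) (h x′ y))

balanced-pasteʸ : ∀ h {x x′ y y′ y″} → Balanced h x x′ y y′ → Balanced h x x′ y′ y″ →
                  Balanced h x x′ y y″
balanced-pasteʸ h {x} {x′} {y} {y′} {y″} bottom top =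
  balanced-transpose h′ {y} {y″} {x} {x′}
    (balanced-pasteˣ h′ (balanced-transpose h bottom) (balanced-transpose h top))
  where
  h′ : ℕ → ℕ → ℕ
  h′ u v = h v u

unitSquares⇒balanced : ∀ h → (∀ x y → Balanced h x (suc x) y (suc y)) →
                       ∀ x y → Balanced h 0 x 0 y
unitSquares⇒balanced h unit = rectangle
  where
  strip : ∀ x y → Balanced h x (suc x) 0 y
  strip x zero    = refl
  strip x (suc y) = balanced-pasteʸ h (strip x y) (unit x y)

  rectangle : ∀ x y → Balanced h 0 x 0 y
  rectangle zero    y = +-comm (h 0 0) (h 0 y)
  rectangle (suc x) y = balanced-pasteˣ h (rectangle x y) (strip x y)

PreservesResidues : (p : ℕ) .{{_ : NonZero p}} → (ℕ → ℕ) → Set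
PreservesResidues p Ψ = ∀ x → Ψ x % p ≡ x % p

rowWindow : ℕ → (ℕ → ℕ → ℕ) → ℕ → ℕ → ℕ
rowWindow p f r c = sumTo p (λ b → f r (c + b))

windowSum : ℕ → (ℕ → ℕ → ℕ) → ℕ → ℕ → ℕ
windowSum p f r c = sumTo p (λ a → rowWindow p f (r + a) c)

windowSum-transpose : ∀ p (f : ℕ → ℕ → ℕ) r c →
                      windowSum p (λ u v → f v u) r c ≡ windowSum p f c r
windowSum-transpose p f r c = sumTo-comm p p (λ a b → f (c + b) (r + a))

windowsConst-transpose : ∀ p (f : ℕ → ℕ → ℕ) → (∀ r c → windowSum p f r c ≡ windowSum p f 0 0) →
                         ∀ r c → windowSum p (λ u v → f v u) r c ≡ windowSum p (λ u v → f v u) 0 0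
windowsConst-transpose p f windows-const r c = begin
  windowSum p (λ u v → f v u) r c ≡⟨ windowSum-transpose p f r c ⟩
  windowSum p f c r               ≡⟨ windows-const c r ⟩
  windowSum p f 0 0               ≡⟨ windowSum-transpose p f 0 0 ⟨
  windowSum p (λ u v → f v u) 0 0 ∎

windowSum-residues : ∀ p .{{_ : NonZero p}} (f : ℕ → ℕ → ℕ) Ψ → PreservesResidues p Ψ → ∀ x y →
                     sumTo p (λ a → sumTo p (λ b → f (Ψ (x + a) % p) (Ψ (y + b) % p)))
                       ≡ sumTo p (λ a → sumTo p (f a))
windowSum-residues p f Ψ Ψ-mod x y = begin
  sumTo p (λ a → sumTo p (λ b → f (Ψ (x + a) % p) (Ψ (y + b) % p)))
    ≡⟨ sumTo-cong p (λ a → sumTo-cong p (λ b → cong₂ f (Ψ-mod (x + a)) (Ψ-mod (y + b)))) ⟩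
  sumTo p (λ a → sumTo p (λ b → f ((x + a) % p) ((y + b) % p)))
    ≡⟨ sumTo-cong p (λ a → sumTo-mod-shift p (f ((x + a) % p)) y) ⟩
  sumTo p (λ a → sumTo p (f ((x + a) % p)))
    ≡⟨ sumTo-mod-shift p (λ u → sumTo p (f u)) x ⟩
  sumTo p (λ a → sumTo p (f a)) ∎

module ConstantWindows (p : ℕ) .{{_ : NonZero p}} (f : ℕ → ℕ → ℕ)
                       (windows-const : ∀ r c → windowSum p f r c ≡ windowSum p f 0 0) where

  rowWindow-periodic : ∀ r c → rowWindow p f (r + p) c ≡ rowWindow p f r c
  rowWindow-periodic r c = +-cancelˡ-≡ (windowSum p f r c) _ _ (begin
    windowSum p f r c + rowWindow p f (r + p) c       ≡⟨ sumTo-slide p (λ a → rowWindow p f a c) r ⟨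
    rowWindow p f r c + windowSum p f (suc r) c       ≡⟨ cong (rowWindow p f r c +_)
                                                          (trans (windows-const (suc r) c) (sym (windows-const r c))) ⟩
    rowWindow p f r c + windowSum p f r c             ≡⟨ +-comm (rowWindow p f r c) _ ⟩
    windowSum p f r c + rowWindow p f r c             ∎)

  rowWindow-periodic* : ∀ t r c → rowWindow p f (r + t * p) c ≡ rowWindow p f r c
  rowWindow-periodic* zero    r c = cong (λ x → rowWindow p f x c) (+-identityʳ r)
  rowWindow-periodic* (suc t) r c = begin
    rowWindow p f (r + (p + t * p)) c ≡⟨ cong (λ x → rowWindow p f x c) (x∙yz≈xz∙y r p (t * p)) ⟩
    rowWindow p f (r + t * p + p) c   ≡⟨ rowWindow-periodic (r + t * p) c ⟩
    rowWindow p f (r + t * p) c       ≡⟨ rowWindow-periodic* t r c ⟩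
    rowWindow p f r c                 ∎

  rowWindow-mod : ∀ r c → rowWindow p f r c ≡ rowWindow p f (r % p) c
  rowWindow-mod r c = trans (cong (λ x → rowWindow p f x c) (m≡m%n+[m/n]*n r p))
                            (rowWindow-periodic* (r / p) (r % p) c)

  -- Sliding a row window one column adds f r (c + p) − f r c; as row windows are
  -- p-periodic in r, so is this difference.
  balanced-step : ∀ r c → Balanced f r (r + p) c (c + p)
  balanced-step r c = +-cancelʳ-≡ (next + this) _ _ (begin
    f r c + f (r + p) (c + p) + (next + this)          ≡⟨ regroup (f r c) (f (r + p) (c + p)) next this ⟩
    (f r c + next) + (this + f (r + p) (c + p))        ≡⟨ cong₂ _+_ (sumTo-slide p (f r) c) shifted ⟩
    (this + f r (c + p)) + (f (r + p) c + next)        ≡⟨ regroup′ this (f r (c + p)) (f (r + p) c) next ⟩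
    f r (c + p) + f (r + p) c + (next + this)          ∎)
    where
    this next : ℕ
    this = rowWindow p f r c
    next = rowWindow p f r (suc c)
    shifted : this + f (r + p) (c + p) ≡ f (r + p) c + next
    shifted = begin
      this + f (r + p) (c + p)                            ≡⟨ cong (_+ f (r + p) (c + p)) (rowWindow-periodic r c) ⟨
      rowWindow p f (r + p) c + f (r + p) (c + p)         ≡⟨ sumTo-slide p (f (r + p)) c ⟨
      f (r + p) c + rowWindow p f (r + p) (suc c)         ≡⟨ cong (f (r + p) c +_) (rowWindow-periodic r (suc c)) ⟩
      f (r + p) c + next                                  ∎
    regroup : ∀ a b c d → a + b + (c + d) ≡ (a + c) + (d + b)
    regroup = solve-∀
    regroup′ : ∀ a b c d → (a + b) + (c + d) ≡ b + c + (d + a)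
    regroup′ = solve-∀

  balanced-lattice : ∀ r c x y → Balanced f r (r + x * p) c (c + y * p)
  balanced-lattice r c x y =
    subst₂ (λ u v → Balanced f u (r + x * p) v (c + y * p)) (+-identityʳ r) (+-identityʳ c)
      (unitSquares⇒balanced h unit x y)
    where
    h : ℕ → ℕ → ℕ
    h i j = f (r + i * p) (c + j * p)
    step : ∀ a i q → a + suc i * q ≡ a + i * q + q
    step = solve-∀
    unit : ∀ i j → Balanced h i (suc i) j (suc j)
    unit i j = subst₂ (λ u v → Balanced f (r + i * p) u (c + j * p) v)
                 (sym (step r i p)) (sym (step c j p)) (balanced-step (r + i * p) (c + j * p))

  balanced-mod : ∀ r c → Balanced f (r % p) r (c % p) c
  balanced-mod r c =
    subst₂ (λ u v → Balanced f (r % p) u (c % p) v)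
      (sym (m≡m%n+[m/n]*n r p)) (sym (m≡m%n+[m/n]*n c p))
      (balanced-lattice (r % p) (c % p) (r / p) (c / p))

  windowSum-colResidues : ∀ Ψ → PreservesResidues p Ψ → ∀ x y →
                          sumTo p (λ a → sumTo p (λ b → f (Ψ (x + a)) (Ψ (y + b) % p)))
                            ≡ sumTo p (λ a → sumTo p (f a))
  windowSum-colResidues Ψ Ψ-mod x y = begin
    sumTo p (λ a → sumTo p (λ b → f (Ψ (x + a)) (Ψ (y + b) % p)))
      ≡⟨ sumTo-cong p (λ a → sumTo-cong p (λ b → cong (f (Ψ (x + a))) (Ψ-mod (y + b)))) ⟩
    sumTo p (λ a → sumTo p (λ b → f (Ψ (x + a)) ((y + b) % p)))
      ≡⟨ sumTo-cong p (λ a → sumTo-mod-shift p (f (Ψ (x + a))) y) ⟩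
    sumTo p (λ a → rowWindow p f (Ψ (x + a)) 0)
      ≡⟨ sumTo-cong p (λ a → trans (rowWindow-mod (Ψ (x + a)) 0)
                                   (cong (λ u → rowWindow p f u 0) (Ψ-mod (x + a)))) ⟩
    sumTo p (λ a → rowWindow p f ((x + a) % p) 0)
      ≡⟨ sumTo-mod-shift p (λ u → rowWindow p f u 0) x ⟩
    sumTo p (λ a → sumTo p (f a)) ∎

-- Ψ permutes {0, …, n − 1}, expressed through its effect on sums.
Permutes : ℕ → (ℕ → ℕ) → Set
Permutes n Ψ = ∀ F → sumTo n (λ i → F (Ψ i)) ≡ sumTo n F

-- The positions (i, col i), i < n, meet every row and every column once, and the
-- residue mod p of the column determines that of the row and conversely.
record Transversal (p n : ℕ) .{{_ : NonZero p}} : Set where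
  field
    col          : ℕ → ℕ
    col-permutes : Permutes n col
    colResidue   : ℕ → ℕ
    rowResidue   : ℕ → ℕ
    col-mod      : ∀ i → i < n → col i % p ≡ colResidue (i % p)
    row-mod      : ∀ i → i < n → i % p ≡ rowResidue (col i % p)

module _ {p n : ℕ} .{{_ : NonZero p}} .{{_ : NonZero n}} (p∣n : p ∣ n) {K : ℕ} (K≤n : K ≤ n) where

  diagonal : Transversal p n
  diagonal = record
    { col          = λ i → (K + i) % n
    ; col-permutes = λ F → sumTo-mod-shift n F K
    ; colResidue   = λ ρ → (K + ρ) % p
    ; rowResidue   = λ σ → (σ + (n ∸ K)) % p
    ; col-mod      = λ i _ → trans (m∣n⇒o%n%m≡o%m p n (K + i) p∣n) (sym ([m+n%d]%d≡[m+n]%d K i p))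
    ; row-mod      = λ i _ → sym (row-mod i)
    }
    where
    row-mod : ∀ i → ((K + i) % n % p + (n ∸ K)) % p ≡ i % p
    row-mod i = begin
      ((K + i) % n % p + (n ∸ K)) % p
        ≡⟨ cong (λ x → (x + (n ∸ K)) % p) (m∣n⇒o%n%m≡o%m p n (K + i) p∣n) ⟩
      ((K + i) % p + (n ∸ K)) % p     ≡⟨ [m%d+n]%d≡[m+n]%d (K + i) (n ∸ K) p ⟩
      (K + i + (n ∸ K)) % p
        ≡⟨ %-congˡ (trans (xy∙z≈xz∙y K i (n ∸ K)) (cong (_+ i) (m+[n∸m]≡n K≤n))) ⟩
      (n + i) % p                     ≡⟨ %-remove-+ˡ i p∣n ⟩
      i % p                           ∎

  antidiagonal : Transversal p n
  antidiagonal = record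
    { col          = λ i → (K + (n ∸ i)) % n
    ; col-permutes = col-permutes
    ; colResidue   = λ ρ → (K + (n ∸ ρ)) % p
    ; rowResidue   = λ σ → (K + n ∸ σ) % p
    ; col-mod      = col-mod
    ; row-mod      = row-mod
    }
    where
    col-permutes : Permutes n (λ i → (K + (n ∸ i)) % n)
    col-permutes F = begin
      sumTo n (λ i → F ((K + (n ∸ i)) % n))  ≡⟨ sumTo-reverse n (λ y → F ((K + y) % n)) ⟩
      sumTo n (λ i → F ((K + suc i) % n))    ≡⟨ sumTo-cong n (λ i → cong (λ x → F (x % n)) (+-suc K i)) ⟩
      sumTo n (λ i → F ((suc K + i) % n))    ≡⟨ sumTo-mod-shift n F (suc K) ⟩
      sumTo n F                              ∎
    col-mod : ∀ i → i < n → (K + (n ∸ i)) % n % p ≡ (K + (n ∸ i % p)) % p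
    col-mod i i<n = begin
      (K + (n ∸ i)) % n % p          ≡⟨ m∣n⇒o%n%m≡o%m p n (K + (n ∸ i)) p∣n ⟩
      (K + (n ∸ i)) % p              ≡⟨ [m+n%d]%d≡[m+n]%d K (n ∸ i) p ⟨
      (K + (n ∸ i) % p) % p          ≡⟨ cong (λ x → (K + x) % p) ([m∸n%d]%d≡[m∸n]%d p (<⇒≤ i<n)) ⟨
      (K + (n ∸ i % p) % p) % p      ≡⟨ [m+n%d]%d≡[m+n]%d K (n ∸ i % p) p ⟩
      (K + (n ∸ i % p)) % p          ∎
    row-mod : ∀ i → i < n → i % p ≡ (K + n ∸ (K + (n ∸ i)) % n % p) % p
    row-mod i i<n = sym (begin
      (K + n ∸ (K + (n ∸ i)) % n % p) % p
        ≡⟨ cong (λ x → (K + n ∸ x) % p) (m∣n⇒o%n%m≡o%m p n (K + (n ∸ i)) p∣n) ⟩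
      (K + n ∸ (K + (n ∸ i)) % p) % p      ≡⟨ [m∸n%d]%d≡[m∸n]%d p (+-monoʳ-≤ K (m∸n≤m n i)) ⟩
      (K + n ∸ (K + (n ∸ i))) % p          ≡⟨ %-congˡ ([m+n]∸[m+o]≡n∸o K n (n ∸ i)) ⟩
      (n ∸ (n ∸ i)) % p                    ≡⟨ %-congˡ (m∸[m∸n]≡n (<⇒≤ i<n)) ⟩
      i % p                                ∎)

-- Both invariance lemmas compare the expansion given by `balanced-mod` for Φ = Ψ and Φ = id.
module _ (p : ℕ) .{{_ : NonZero p}} (f : ℕ → ℕ → ℕ)
         (windows-const : ∀ r c → windowSum p f r c ≡ windowSum p f 0 0) where

  private
    module Rows = ConstantWindows p f windows-const
    module Cols = ConstantWindows p (λ u v → f v u) (windowsConst-transpose p f windows-const)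

  windowSum-invariant : ∀ Ψ → PreservesResidues p Ψ → ∀ x y →
                        sumTo p (λ a → sumTo p (λ b → f (Ψ (x + a)) (Ψ (y + b)))) ≡ windowSum p f x y
  windowSum-invariant Ψ Ψ-mod x y =
    +-cancelˡ-≡ residues _ _ (trans (split Ψ Ψ-mod) (sym (split (λ z → z) (λ _ → refl))))
    where
    residues : ℕ
    residues = sumTo p (λ a → sumTo p (f a))
    split : ∀ Φ → PreservesResidues p Φ →
            residues + sumTo p (λ a → sumTo p (λ b → f (Φ (x + a)) (Φ (y + b))))
              ≡ residues + sumTo p (λ a → sumTo p (λ b → f b a))
    split Φ Φ-mod = begin
      residues + sumTo p (λ a → sumTo p (λ b → f (Φ (x + a)) (Φ (y + b))))
        ≡⟨ cong (_+ sumTo p (λ a → sumTo p (λ b → f (Φ (x + a)) (Φ (y + b)))))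
                (windowSum-residues p f Φ Φ-mod x y) ⟨
      sumTo p (λ a → sumTo p (λ b → f (Φ (x + a) % p) (Φ (y + b) % p)))
        + sumTo p (λ a → sumTo p (λ b → f (Φ (x + a)) (Φ (y + b))))
        ≡⟨ sumTo-cong-+ p (λ a → sumTo-cong-+ p (λ b → Rows.balanced-mod (Φ (x + a)) (Φ (y + b)))) ⟩
      sumTo p (λ a → sumTo p (λ b → f (Φ (x + a) % p) (Φ (y + b))))
        + sumTo p (λ a → sumTo p (λ b → f (Φ (x + a)) (Φ (y + b) % p)))
        ≡⟨ cong₂ _+_ (trans (sumTo-comm p p (λ a b → f (Φ (x + a) % p) (Φ (y + b))))
                            (Cols.windowSum-colResidues Φ Φ-mod y x))
                     (Rows.windowSum-colResidues Φ Φ-mod x y) ⟩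
      sumTo p (λ a → sumTo p (λ b → f b a)) + residues
        ≡⟨ +-comm _ residues ⟩
      residues + sumTo p (λ a → sumTo p (λ b → f b a)) ∎

  transversalSum-invariant : ∀ n (T : Transversal p n) → let open Transversal T in
                             ∀ Ψ → PreservesResidues p Ψ → Permutes n Ψ →
                             sumTo n (λ i → f (Ψ i) (Ψ (col i))) ≡ sumTo n (λ i → f i (col i))
  transversalSum-invariant n T Ψ Ψ-mod Ψ-perm =
    +-cancelˡ-≡ residues _ _ (trans (split Ψ Ψ-mod Ψ-perm) (sym (split (λ z → z) (λ _ → refl) (λ _ → refl))))
    where
    open Transversal T
    residues : ℕ
    residues = sumTo n (λ i → f (i % p) (col i % p))
    split : ∀ Φ → PreservesResidues p Φ → Permutes n Φ →
            residues + sumTo n (λ i → f (Φ i) (Φ (col i)))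
              ≡ sumTo n (λ z → f (rowResidue (z % p)) z) + sumTo n (λ z → f z (colResidue (z % p)))
    split Φ Φ-mod Φ-perm = begin
      residues + sumTo n (λ i → f (Φ i) (Φ (col i)))
        ≡⟨ cong (_+ sumTo n (λ i → f (Φ i) (Φ (col i))))
                (sumTo-cong n (λ i → cong₂ f (Φ-mod i) (Φ-mod (col i)))) ⟨
      sumTo n (λ i → f (Φ i % p) (Φ (col i) % p)) + sumTo n (λ i → f (Φ i) (Φ (col i)))
        ≡⟨ sumTo-cong-+ n (λ i → Rows.balanced-mod (Φ i) (Φ (col i))) ⟩
      sumTo n (λ i → f (Φ i % p) (Φ (col i))) + sumTo n (λ i → f (Φ i) (Φ (col i) % p))
        ≡⟨ cong₂ _+_ rowSide colSide ⟩
      sumTo n (λ z → f (rowResidue (z % p)) z) + sumTo n (λ z → f z (colResidue (z % p))) ∎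
      where
      rowSide : sumTo n (λ i → f (Φ i % p) (Φ (col i))) ≡ sumTo n (λ z → f (rowResidue (z % p)) z)
      rowSide = begin
        sumTo n (λ i → f (Φ i % p) (Φ (col i)))
          ≡⟨ sumTo-cong< n (λ i i<n → cong (λ u → f u (Φ (col i)))
                 (trans (Φ-mod i) (trans (row-mod i i<n) (cong rowResidue (sym (Φ-mod (col i))))))) ⟩
        sumTo n (λ i → f (rowResidue (Φ (col i) % p)) (Φ (col i)))
          ≡⟨ col-permutes (λ y → f (rowResidue (Φ y % p)) (Φ y)) ⟩
        sumTo n (λ y → f (rowResidue (Φ y % p)) (Φ y))
          ≡⟨ Φ-perm (λ z → f (rowResidue (z % p)) z) ⟩
        sumTo n (λ z → f (rowResidue (z % p)) z) ∎
      colSide : sumTo n (λ i → f (Φ i) (Φ (col i) % p)) ≡ sumTo n (λ z → f z (colResidue (z % p)))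
      colSide = begin
        sumTo n (λ i → f (Φ i) (Φ (col i) % p))
          ≡⟨ sumTo-cong< n (λ i i<n → cong (f (Φ i))
                 (trans (Φ-mod (col i)) (trans (col-mod i i<n) (cong colResidue (sym (Φ-mod i)))))) ⟩
        sumTo n (λ i → f (Φ i) (colResidue (Φ i % p)))
          ≡⟨ Φ-perm (λ z → f z (colResidue (z % p))) ⟩
        sumTo n (λ z → f z (colResidue (z % p))) ∎

  -- Moving the μ-th window down by μ·m rows leaves its sum unchanged; then each column offset
  -- β < p collects a complementary p-tuple.
  complementaryWindows : ∀ {m} → p ∣ m → ∀ N →
                         (∀ r c → 2 * sumTo p (λ μ → f (r + μ * m) (c + μ * m)) ≡ p * N) →
                         ∀ r c → 2 * sumTo p (λ μ → rowWindow p f r (c + μ * m)) ≡ p * (p * N)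
  complementaryWindows {m} (divides t m≡t*p) N complementary r c = begin
    2 * sumTo p (λ μ → rowWindow p f r (c + μ * m))
      ≡⟨ cong (2 *_) (sumTo-cong p (λ μ →
           sym (trans (cong (λ k → rowWindow p f (r + k) (c + μ * m)) (μ*m≡ μ))
                      (Rows.rowWindow-periodic* (μ * t) r (c + μ * m))))) ⟩
    2 * sumTo p (λ μ → sumTo p (λ β → f (r + μ * m) (c + μ * m + β)))
      ≡⟨ cong (2 *_) (sumTo-comm p p _) ⟩
    2 * sumTo p (λ β → sumTo p (λ μ → f (r + μ * m) (c + μ * m + β)))
      ≡⟨ cong (2 *_) (sumTo-cong p (λ β → sumTo-cong p (λ μ →
           cong (f (r + μ * m)) (xy∙z≈xz∙y c (μ * m) β)))) ⟩
    2 * sumTo p (λ β → sumTo p (λ μ → f (r + μ * m) (c + β + μ * m)))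
      ≡⟨ sumTo-*ˡ p 2 _ ⟨
    sumTo p (λ β → 2 * sumTo p (λ μ → f (r + μ * m) (c + β + μ * m)))
      ≡⟨ sumTo-cong p (λ β → complementary r (c + β)) ⟩
    sumTo p (λ _ → p * N)
      ≡⟨ sumTo-const p (p * N) ⟩
    p * (p * N) ∎
    where
    μ*m≡ : ∀ μ → μ * m ≡ μ * t * p
    μ*m≡ μ = trans (cong (μ *_) m≡t*p) (sym (*-assoc μ t p))

÷≡/ : ∀ m d .{{_ : NonZero d}} → m ÷ d ≡ m / d
÷≡/ m (suc _) = refl

θidx-blocks : ∀ p n {B} .{{_ : NonZero B}} → n ÷ (p * p) ≡ B → ∀ r →
        θidx p n r ≡ bar p (r / B) * B + r % B
θidx-blocks p n {suc _} n÷p²≡B r with n ÷ (p * p)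
θidx-blocks p n {suc _} refl     r | _ = refl

module BlockTranspose (p B n : ℕ) .{{_ : NonZero p}} .{{_ : NonZero B}} .{{_ : NonZero n}}
                      (n≡ : n ≡ p * p * B) where

  Θ : ℕ → ℕ
  Θ x = θidx p n (x % n)

  private instance
    p²≢0 : NonZero (p * p)
    p²≢0 = m*n≢0 p p

  n÷p²≡B : n ÷ (p * p) ≡ B
  n÷p²≡B = begin
    n ÷ (p * p)       ≡⟨ ÷≡/ n (p * p) ⟩
    n / (p * p)       ≡⟨ /-congˡ {o = p * p} (trans n≡ (*-comm (p * p) B)) ⟩
    B * (p * p) / (p * p) ≡⟨ m*n/n≡m B (p * p) ⟩
    B                 ∎

  Θ-block : ∀ {j o} → j < p * p → o < B → Θ (j * B + o) ≡ bar p j * B + o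
  Θ-block {j} {o} j<p² o<B = begin
    θidx p n ((j * B + o) % n)                   ≡⟨ cong (θidx p n) (m<n⇒m%n≡m j*B+o<n) ⟩
    θidx p n (j * B + o)                         ≡⟨ θidx-blocks p n n÷p²≡B (j * B + o) ⟩
    bar p ((j * B + o) / B) * B + (j * B + o) % B ≡⟨ cong₂ (λ u v → bar p u * B + v)
                                                       ([j*b+o]/b≡j B j o<B) ([j*b+o]%b≡o B j o<B) ⟩
    bar p j * B + o                              ∎
    where
    j*B+o<n : j * B + o < n
    j*B+o<n = subst (j * B + o <_) (sym n≡) (j*b+o<a*b B j<p² o<B)

  Θ-permutes : Permutes n Θ
  Θ-permutes F = begin
    sumTo n (λ i → F (Θ i))                           ≡⟨ cong (λ m → sumTo m (λ i → F (Θ i))) n≡ ⟩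
    sumTo (p * p * B) (λ i → F (Θ i))                 ≡⟨ sumTo-blocks (p * p) B _ ⟩
    sumTo (p * p) (λ j → sumTo B (λ o → F (Θ (j * B + o))))
      ≡⟨ sumTo-cong< (p * p) (λ j j<p² → sumTo-cong< B (λ o o<B → cong F (Θ-block j<p² o<B))) ⟩
    sumTo (p * p) (λ j → G (bar p j))                 ≡⟨ sumTo-blocks p p _ ⟩
    sumTo p (λ l → sumTo p (λ m → G (bar p (l * p + m))))
      ≡⟨ sumTo-cong p (λ l → sumTo-cong< p (λ m m<p → cong G (bar-swap p l m<p))) ⟩
    sumTo p (λ l → sumTo p (λ m → G (m * p + l)))     ≡⟨ sumTo-comm p p _ ⟩
    sumTo p (λ m → sumTo p (λ l → G (m * p + l)))     ≡⟨ sumTo-blocks p p G ⟨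
    sumTo (p * p) G                                   ≡⟨ sumTo-blocks (p * p) B F ⟨
    sumTo (p * p * B) F                               ≡⟨ cong (λ m → sumTo m F) n≡ ⟨
    sumTo n F                                         ∎
    where
    G : ℕ → ℕ
    G j = sumTo B (λ o → F (j * B + o))

  ∣B⇒∣n : ∀ {d} → d ∣ B → d ∣ n
  ∣B⇒∣n d∣B = subst (_ ∣_) (sym n≡) (∣n⇒∣m*n (p * p) d∣B)

  Θ-mod : p ∣ B → PreservesResidues p Θ
  Θ-mod p∣B x = begin
    θidx p n r % p                         ≡⟨ %-congˡ (θidx-blocks p n n÷p²≡B r) ⟩
    (bar p (r / B) * B + r % B) % p        ≡⟨ %-remove-+ˡ (r % B) (∣n⇒∣m*n (bar p (r / B)) p∣B) ⟩
    r % B % p                              ≡⟨ %-remove-+ˡ (r % B) (∣n⇒∣m*n (r / B) p∣B) ⟨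
    (r / B * B + r % B) % p                ≡⟨ %-congˡ (trans (+-comm _ (r % B)) (sym (m≡m%n+[m/n]*n r B))) ⟩
    r % p                                  ≡⟨ m∣n⇒o%n%m≡o%m p n x (∣B⇒∣n p∣B) ⟩
    x % p                                  ∎
    where
    r : ℕ
    r = x % n

  Θ-band : ∀ {s} → s < p → ∀ F →
           sumTo (p * B) (λ i → F (Θ (s * (p * B) + i)))
             ≡ sumTo p (λ μ → sumTo B (λ o → F (μ * (p * B) + s * B + o)))
  Θ-band {s} s<p F = begin
    sumTo (p * B) (λ i → F (Θ (s * (p * B) + i)))
      ≡⟨ sumTo-blocks p B _ ⟩
    sumTo p (λ μ → sumTo B (λ o → F (Θ (s * (p * B) + (μ * B + o)))))
      ≡⟨ sumTo-cong< p (λ μ μ<p → sumTo-cong< B (λ o o<B → cong F (index μ<p o<B))) ⟩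
    sumTo p (λ μ → sumTo B (λ o → F (μ * (p * B) + s * B + o))) ∎
    where
    index : ∀ {μ o} → μ < p → o < B → Θ (s * (p * B) + (μ * B + o)) ≡ μ * (p * B) + s * B + o
    index {μ} {o} μ<p o<B = begin
      Θ (s * (p * B) + (μ * B + o))   ≡⟨ cong Θ (regroup s p B μ o) ⟩
      Θ ((s * p + μ) * B + o)         ≡⟨ Θ-block (j*b+o<a*b p s<p μ<p) o<B ⟩
      bar p (s * p + μ) * B + o       ≡⟨ cong (λ j → j * B + o) (bar-swap p s μ<p) ⟩
      (μ * p + s) * B + o             ≡⟨ regroup′ μ p s B o ⟩
      μ * (p * B) + s * B + o         ∎
      where
      regroup : ∀ s p B μ o → s * (p * B) + (μ * B + o) ≡ (s * p + μ) * B + o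
      regroup = solve-∀
      regroup′ : ∀ μ p s B o → (μ * p + s) * B + o ≡ μ * (p * B) + s * B + o
      regroup′ = solve-∀

ent-cong-% : ∀ {n} .{{_ : NonZero n}} (R : Square n) {x x′ y y′} →
             x % n ≡ x′ % n → y % n ≡ y′ % n → ent R x y ≡ ent R x′ y′
ent-cong-% {suc k} R {x} {x′} {y} {y′} x≡x′ y≡y′ =
  cong₂ R (idx-cong {x} {x′} x≡x′) (idx-cong {y} {y′} y≡y′)
  where
  idx-cong : ∀ {u u′} → u % suc k ≡ u′ % suc k → idx k u ≡ idx k u′
  idx-cong {u} {u′} eq =
    toℕ-injective (trans (toℕ-fromℕ< (m%n<n u (suc k))) (trans eq (sym (toℕ-fromℕ< (m%n<n u′ (suc k))))))

ent-θ : ∀ p {n} .{{_ : NonZero n}} (R : Square n) x y →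
        ent (θ p R) x y ≡ ent R (θidx p n (x % n)) (θidx p n (y % n))
ent-θ p {suc k} R x y =
  cong₂ (λ u v → ent R (θidx p (suc k) u) (θidx p (suc k) v)) (toℕ-fromℕ< _) (toℕ-fromℕ< _)

at-% : ∀ {n} .{{_ : NonZero n}} (P : ℕ → Set) → (∀ (r : Fin n) → P (toℕ r)) → ∀ x → P (x % n)
at-% {n} P H x = subst P (toℕ-fromℕ< (m%n<n x n)) (H (fromℕ< (m%n<n x n)))

at-%² : ∀ {n} .{{_ : NonZero n}} (P : ℕ → ℕ → Set) → (∀ (r c : Fin n) → P (toℕ r) (toℕ c)) →
        ∀ x y → P (x % n) (y % n)
at-%² {n} P H x y = at-% (P (x % n)) (at-% (λ r → ∀ c → P r (toℕ c)) H x) y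

module TransferToθ (p q n : ℕ) .{{_ : NonZero p}} .{{_ : NonZero q}} .{{_ : NonZero n}}
                (n≡ : n ≡ q * (p * p * p)) (R : Square n) where

  B m N : ℕ
  B = q * p
  m = p * B
  N = n * n ∸ 1

  private instance
    B≢0 : NonZero B
    B≢0 = m*n≢0 q p

  n≡p²B : n ≡ p * p * B
  n≡p²B = trans n≡ (reorder q p)
    where
    reorder : ∀ q p → q * (p * p * p) ≡ p * p * (q * p)
    reorder = solve-∀

  open BlockTranspose p B n n≡p²B

  p∣B : p ∣ B
  p∣B = n∣m*n q

  p∣n : p ∣ n
  p∣n = ∣B⇒∣n p∣B

  n÷p≡m : n ÷ p ≡ m
  n÷p≡m = begin
    n ÷ p           ≡⟨ ÷≡/ n p ⟩
    n / p           ≡⟨ /-congˡ {o = p} (trans n≡p²B (reorder p B)) ⟩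
    m * p / p       ≡⟨ m*n/n≡m m p ⟩
    m               ∎
    where
    reorder : ∀ p B → p * p * B ≡ p * B * p
    reorder = solve-∀

  f : ℕ → ℕ → ℕ
  f = ent R

  θ-entry : ∀ x y → ent (θ p R) x y ≡ f (Θ x) (Θ y)
  θ-entry = ent-θ p R

  f-shift-% : ∀ x y a b → f (x % n + a) (y % n + b) ≡ f (x + a) (y + b)
  f-shift-% x y a b = ent-cong-% R ([m%d+n]%d≡[m+n]%d x a n) ([m%d+n]%d≡[m+n]%d y b n)

  lineSum-θ : (g : ℕ → ℕ → ℕ) → (∀ x y → g (x % n) y ≡ g x y) →
              (∀ (r : Fin n) → 2 * sumTo n (g (toℕ r)) ≡ n * N) →
              ∀ x → 2 * sumTo n (λ c → g (Θ x) (Θ c)) ≡ n * N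
  lineSum-θ g g-% lines x = begin
    2 * sumTo n (λ c → g (Θ x) (Θ c)) ≡⟨ cong (2 *_) (Θ-permutes (g (Θ x))) ⟩
    2 * sumTo n (g (Θ x))             ≡⟨ cong (2 *_) (sumTo-cong n (g-% (Θ x))) ⟨
    2 * sumTo n (g (Θ x % n))         ≡⟨ at-% (λ r → 2 * sumTo n (g r) ≡ n * N) lines (Θ x) ⟩
    n * N                             ∎

  θ-rows : RowsMagic R → RowsMagic (θ p R)
  θ-rows rows r = trans (cong (2 *_) (sumTo-cong n (θ-entry (toℕ r))))
                        (lineSum-θ f (λ x _ → ent-cong-% R (m%n%n≡m%n x n) refl) rows (toℕ r))

  θ-cols : ColsMagic R → ColsMagic (θ p R)
  θ-cols cols c = trans (cong (2 *_) (sumTo-cong n (λ r → θ-entry r (toℕ c))))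
                        (lineSum-θ (λ u v → f v u) (λ x _ → ent-cong-% R refl (m%n%n≡m%n x n)) cols (toℕ c))

  bandSum-θ : (g : ℕ → ℕ → ℕ) → (∀ r c → windowSum p g r c ≡ windowSum p g 0 0) →
              (∀ r c → 2 * sumTo p (λ μ → g (r + μ * m) (c + μ * m)) ≡ p * N) →
              ∀ ρ {s} → s < p → 2 * p * sumTo m (λ i → g ρ (Θ (s * m + i))) ≡ n * N
  bandSum-θ g g-windows g-complementary ρ {s} s<p = begin
    2 * p * sumTo m (λ i → g ρ (Θ (s * m + i)))
      ≡⟨ cong (2 * p *_) (Θ-band s<p (g ρ)) ⟩
    2 * p * sumTo p (λ μ → sumTo B (λ o → g ρ (μ * m + s * B + o)))
      ≡⟨ cong (2 * p *_) (sumTo-cong p (λ μ → sumTo-blocks q p _)) ⟩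
    2 * p * sumTo p (λ μ → sumTo q (λ κ → sumTo p (λ β → g ρ (μ * m + s * B + (κ * p + β)))))
      ≡⟨ cong (2 * p *_) (sumTo-comm p q _) ⟩
    2 * p * sumTo q (λ κ → sumTo p (λ μ → sumTo p (λ β → g ρ (μ * m + s * B + (κ * p + β)))))
      ≡⟨ cong (2 * p *_) (sumTo-cong q (λ κ → sumTo-cong p (λ μ → sumTo-cong p (λ β →
           cong (g ρ) (regroup (μ * m) (s * B) (κ * p) β))))) ⟩
    2 * p * sumTo q (λ κ → sumTo p (λ μ → rowWindow p g ρ (s * B + κ * p + μ * m)))
      ≡⟨ reassoc 2 p _ ⟩
    p * (2 * sumTo q (λ κ → sumTo p (λ μ → rowWindow p g ρ (s * B + κ * p + μ * m))))
      ≡⟨ cong (p *_) (sumTo-*ˡ q 2 _) ⟨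
    p * sumTo q (λ κ → 2 * sumTo p (λ μ → rowWindow p g ρ (s * B + κ * p + μ * m)))
      ≡⟨ cong (p *_) (sumTo-cong q (λ κ →
           complementaryWindows p g g-windows (m∣m*n B) N g-complementary ρ (s * B + κ * p))) ⟩
    p * sumTo q (λ _ → p * (p * N))
      ≡⟨ cong (p *_) (sumTo-const q (p * (p * N))) ⟩
    p * (q * (p * (p * N)))
      ≡⟨ reorder p q N ⟩
    q * (p * p * p) * N
      ≡⟨ cong (_* N) n≡ ⟨
    n * N ∎
    where
    regroup : ∀ a b c d → a + b + (c + d) ≡ b + c + a + d
    regroup = solve-∀
    reassoc : ∀ a b c → a * b * c ≡ b * (a * c)
    reassoc = solve-∀
    reorder : ∀ p q N → p * (q * (p * (p * N))) ≡ q * (p * p * p) * N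
    reorder = solve-∀

  module _ (pxp : PxPProperty p R) where

    windows : ∀ x y → 2 * windowSum p f x y ≡ p * p * N
    windows x y = begin
      2 * windowSum p f x y             ≡⟨ cong (2 *_) (sumTo-cong p (λ a → sumTo-cong p (f-shift-% x y a))) ⟨
      2 * windowSum p f (x % n) (y % n) ≡⟨ at-%² (λ r c → 2 * windowSum p f r c ≡ p * p * N) pxp x y ⟩
      p * p * N                         ∎

    windows-const : ∀ r c → windowSum p f r c ≡ windowSum p f 0 0
    windows-const r c = *-cancelˡ-≡ _ _ 2 (trans (windows r c) (sym (windows 0 0)))

    θ-pxp : PxPProperty p (θ p R)
    θ-pxp r c = begin
      2 * windowSum p (ent (θ p R)) (toℕ r) (toℕ c)
        ≡⟨ cong (2 *_) (sumTo-cong p (λ a → sumTo-cong p (λ b → θ-entry (toℕ r + a) (toℕ c + b)))) ⟩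
      2 * sumTo p (λ a → sumTo p (λ b → f (Θ (toℕ r + a)) (Θ (toℕ c + b))))
        ≡⟨ cong (2 *_) (windowSum-invariant p f windows-const Θ (Θ-mod p∣B) (toℕ r) (toℕ c)) ⟩
      2 * windowSum p f (toℕ r) (toℕ c)
        ≡⟨ windows (toℕ r) (toℕ c) ⟩
      p * p * N ∎

    transversalSum-θ : (T : Transversal p n) → let open Transversal T in
                       (col′ : ℕ → ℕ) → (∀ i → col′ i % n ≡ col i % n) →
                       sumTo n (λ i → ent (θ p R) i (col′ i)) ≡ sumTo n (λ i → f i (col′ i))
    transversalSum-θ T col′ col′≡ = begin
      sumTo n (λ i → ent (θ p R) i (col′ i))
        ≡⟨ sumTo-cong n (λ i →
             trans (θ-entry i (col′ i)) (cong (λ x → f (Θ i) (θidx p n x)) (col′≡ i))) ⟩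
      sumTo n (λ i → f (Θ i) (Θ (col i)))
        ≡⟨ transversalSum-invariant p f windows-const n T Θ (Θ-mod p∣B) Θ-permutes ⟩
      sumTo n (λ i → f i (col i))
        ≡⟨ sumTo-cong n (λ i → ent-cong-% R refl (sym (col′≡ i))) ⟩
      sumTo n (λ i → f i (col′ i)) ∎
      where open Transversal T

    θ-pandiagonal : Pandiagonal R → Pandiagonal (θ p R)
    θ-pandiagonal (diag , anti) =
      (λ k → trans (cong (2 *_) (transversalSum-θ (diagonal p∣n (K≤n k)) (toℕ k +_)
                                                    (λ i → sym (m%n%n≡m%n (toℕ k + i) n))))
                   (diag k)) ,
      (λ k → trans (cong (2 *_) (transversalSum-θ (antidiagonal p∣n (K≤n k)) (λ i → toℕ k + (n ∸ i))
                                                    (λ i → sym (m%n%n≡m%n (toℕ k + (n ∸ i)) n))))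
                   (anti k))
      where
      K≤n : (k : Fin n) → toℕ k ≤ n
      K≤n k = <⇒≤ (toℕ<n k)

    module _ (comp : Complementary p R) where

      complementary : ∀ r c → 2 * sumTo p (λ μ → f (r + μ * m) (c + μ * m)) ≡ p * N
      complementary r c = begin
        2 * sumTo p (λ μ → f (r + μ * m) (c + μ * m))
          ≡⟨ cong (2 *_) (sumTo-cong p (λ μ → f-shift-% r c (μ * m) (μ * m))) ⟨
        2 * sumTo p (λ μ → f (r % n + μ * m) (c % n + μ * m))
          ≡⟨ at-%² (λ u v → 2 * sumTo p (λ μ → f (u + μ * m) (v + μ * m)) ≡ p * N) comp′ r c ⟩
        p * N ∎
        where
        comp′ : ∀ (u v : Fin n) → 2 * sumTo p (λ μ → f (toℕ u + μ * m) (toℕ v + μ * m)) ≡ p * N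
        comp′ u v = subst (λ d → 2 * sumTo p (λ μ → f (toℕ u + μ * d) (toℕ v + μ * d)) ≡ p * N)
                          n÷p≡m (comp u v)

      θ-rowPart : RowPart p (θ p R)
      θ-rowPart r s s<p =
        subst (λ d → 2 * p * sumTo d (λ i → ent (θ p R) (toℕ r) (s * d + i)) ≡ n * N) (sym n÷p≡m)
          (trans (cong (2 * p *_) (sumTo-cong m (λ i → θ-entry (toℕ r) (s * m + i))))
                 (bandSum-θ f windows-const complementary (Θ (toℕ r)) s<p))

      θ-colPart : ColPart p (θ p R)
      θ-colPart c s s<p =
        subst (λ d → 2 * p * sumTo d (λ i → ent (θ p R) (s * d + i) (toℕ c)) ≡ n * N) (sym n÷p≡m)
          (trans (cong (2 * p *_) (sumTo-cong m (λ i → θ-entry (s * m + i) (toℕ c))))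
                 (bandSum-θ (λ u v → f v u) (windowsConst-transpose p f windows-const)
                            (λ r c → complementary c r) (Θ (toℕ c)) s<p))

proposition2p6 : (p n : ℕ) → Prime p → 0 < n → p * p * p ∣ n →
    (R : Square n) → MostPerfect p R →
    SemiMagic (θ p R) × PxPProperty p (θ p R) × RowPart p (θ p R) ×
      ColPart p (θ p R) × Pandiagonal (θ p R)
proposition2p6 p n p-prime 0<n (divides q n≡) R ((_ , (rows , cols) , pandiagonal) , pxp , comp) =
  (θ-rows rows , θ-cols cols) , θ-pxp pxp , θ-rowPart pxp comp , θ-colPart pxp comp ,
  θ-pandiagonal pxp pandiagonal
  where
  instance
    p≢0 : NonZero p
    p≢0 = prime⇒nonZero p-prime
    n≢0 : NonZero n
    n≢0 = >-nonZero 0<n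
    q≢0 : NonZero q
    q≢0 = m*n≢0⇒m≢0 q {{subst NonZero n≡ n≢0}}
  open TransferToθ p q n n≡ R
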